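{- If $G$ is a simple connected graph with $n\ge1$ vertices, then $\rho_{\mathrm{opt}}(G)\le\left\lceil \frac{n+1}{2}\right\rceil$.
   Context: A pebble distribution on $G$ is a function $p:V(G)\to\mathbb{Z}_{\ge0}$, of size $\sum_v p(v)$. The pebbling move $(v,v\to u)$ (for an edge $\{v,u\}$) removes two pebbles from $v$ and adds one at $u$; the strict rubbling move $(v,w\to u)$ (for $v\ne w$, both adjacent to $u$) removes one pebble from each of $v,w$ and adds one at $u$. A vertex is reachable from $p$ if some finite sequence of these moves, keeping all intermediate distributions nonnegative, puts at least one pebble on it. The optimal rubbling number $\rho_{\mathrm{opt}}(G)$ is the minimum size of a pebble distribution from which every vertex of $G$ is reachable. -}

module Defs where

open import Data.Nat using (ℕ; zero; suc; _+_; _≤_; _/_)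
open import Data.Fin using (Fin) renaming (zero to fzero; suc to fsuc)
open import Data.Product using (Σ; _×_; ∃-syntax)
open import Data.Vec.Functional using (updateAt)
open import Data.Nat.Properties using ()
open import Relation.Binary.PropositionalEquality using (_≡_)
open import Relation.Nullary using (¬_)
open import Relation.Binary.Construct.Closure.ReflexiveTransitive using (Star)

record SimpleGraph (n : ℕ) : Set₁ where
  field
    Adj   : Fin n → Fin n → Set
    sym   : ∀ {u v} → Adj u v → Adj v u
    irrefl : ∀ {v} → ¬ Adj v v

open SimpleGraph public

data Walk {n : ℕ} (G : SimpleGraph n) : Fin n → Fin n → Set where
  here : ∀ {v} → Walk G v v
  step : ∀ {u v w} → Adj G u v → Walk G v w → Walk G u w

Connected : ∀ {n} → SimpleGraph n → Set
Connected G = ∀ u v → Walk G u v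

Distribution : ℕ → Set
Distribution n = Fin n → ℕ

size : ∀ {n} → Distribution n → ℕ
size {zero}  p = 0
size {suc n} p = p fzero + size {n} (λ i → p (fsuc i))

-- One move (pebbling or strict rubbling), written p ⟶ q.
-- Nonnegativity is enforced by requiring p to equal q' plus the removed pebbles.
data Move {n : ℕ} (G : SimpleGraph n) : Distribution n → Distribution n → Set where
  pebble : ∀ (p : Distribution n) (v u : Fin n) (k : ℕ) →
           Adj G v u → p v ≡ suc (suc k) →
           Move G p (updateAt (updateAt p v (λ _ → k)) u suc)
  rubble : ∀ (p : Distribution n) (v w u : Fin n) (a b : ℕ) →
           ¬ v ≡ w → Adj G v u → Adj G w u →
           p v ≡ suc a → p w ≡ suc b →
           Move G p (updateAt (updateAt (updateAt p v (λ _ → a)) w (λ _ → b)) u suc)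

Reachable : ∀ {n} → SimpleGraph n → Distribution n → Fin n → Set
Reachable G p t = ∃[ q ] (Star (Move G) p q × 1 ≤ q t)

Solvable : ∀ {n} → SimpleGraph n → Distribution n → Set
Solvable G p = ∀ t → Reachable G p t

-- ρ_opt(G) ≤ m : there is a solvable distribution of size at most m
-- (ρ_opt is the minimum size of a solvable distribution, so ρ_opt(G) ≤ m iff this holds).
OptRubblingAtMost : ∀ {n} → SimpleGraph n → ℕ → Set
OptRubblingAtMost G m = ∃[ p ] (Solvable G p × size p ≤ m)

-- ⌈(n+1)/2⌉ = ⌊(n+2)/2⌋
ceilHalfSucc : ℕ → ℕ
ceilHalfSucc n = (n + 2) / 2

module Submission where

-- Fix a spanning tree and place pebbles bottom-up.  A subtree T hanging from a
-- vertex u gets a plan of one of two kinds: either every vertex of T becomes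
-- reachable once the root c of T is supplied with a pebble, at a cost of at most
-- (|T| - 1)/2 pebbles, or once u is supplied with a pebble, at a cost of at most
-- |T|/2.  Let k be the number of children of c whose plans are of the first kind.
-- If k = 0, the plans of the children already form a plan of the first kind for T.
-- If k = 1, one extra pebble on that child g turns a pebble at u into one at c by
-- the rubbling move (u, g → c).  If k ≥ 2, one extra pebble on c makes two there,
-- enough to pebble every such child.  Every child of the first kind saves half a
-- pebble, which pays for the extra pebble; at the root the same count gives
-- ⌈(n + 1)/2⌉.

open import Defs hiding (sym)
open import Data.Nat using (ℕ; zero; suc; _+_; _*_; _≤_; _<_; z≤n; s≤s; _/_)
open import Data.Nat.Properties
open import Data.Nat.DivMod using (m*n/n≡m; /-monoˡ-≤)
open import Data.Nat.Tactic.RingSolver using (solve-∀)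
open import Algebra.Properties.CommutativeSemigroup +-commutativeSemigroup using (interchange)
open import Data.Fin using (Fin) renaming (zero to fzero; suc to fsuc)
open import Data.Fin.Properties using (all?; ¬∀⟶∃¬) renaming (_≟_ to _≟ᶠ_)
open import Data.Fin.Subset using (Subset; _∈_; _∉_; _∪_; ⁅_⁆; ∣_∣)
open import Data.Fin.Subset.Properties
  using (_∈?_; ∈⊤; x∈⁅x⁆; x∈⁅y⁆⇒x≡y; x∈p∪q⁺; x∈p∪q⁻; p⊆p∪q; p⊂q⇒∣p∣<∣q∣; ∣p∣≤n; ∣⊤∣≡n; ∣⁅x⁆∣≡1)
open import Data.List using (List; []; _∷_; length)
open import Data.List.Relation.Unary.All using (All; []; _∷_) renaming (map to All-map)
open import Data.Product using (Σ; _×_; _,_; ∃-syntax)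
open import Data.Sum using (_⊎_; inj₁; inj₂)
open import Data.Vec.Functional using (updateAt)
open import Data.Vec.Functional.Properties using (updateAt-updates; updateAt-minimal)
open import Relation.Binary.PropositionalEquality
open import Relation.Nullary using (¬_; yes; no; contradiction)
open import Relation.Unary using (Pred; Decidable)
open import Relation.Binary.Construct.Closure.ReflexiveTransitive using (Star; ε; _◅_; _◅◅_)

k+m≤n⇒∃n′ : ∀ k {m n} → k + m ≤ n → ∃[ n′ ] (n ≡ k + n′ × m ≤ n′)
k+m≤n⇒∃n′ zero    m≤n = _ , refl , m≤n
k+m≤n⇒∃n′ (suc k) (s≤s k+m≤n) with k+m≤n⇒∃n′ k k+m≤n
... | n′ , refl , m≤n′ = n′ , refl , m≤n′

double-+-mono-≤ : ∀ {a b e k x y} → e + (a + a) ≤ x → k + (b + b) ≤ y →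
                  (e + k) + ((a + b) + (a + b)) ≤ x + y
double-+-mono-≤ {a} {b} {e} {k} ha hb = ≤-trans (≤-reflexive (regroup a b e k)) (+-mono-≤ ha hb)
  where
  regroup : ∀ a b e k → (e + k) + ((a + b) + (a + b)) ≡ (e + (a + a)) + (k + (b + b))
  regroup = solve-∀

double-shift-≤ : ∀ {s e f} d e′ c → e + (s + s) ≤ f → e′ + (d + d) ≤ e + c →
                 e′ + ((d + s) + (d + s)) ≤ c + f
double-shift-≤ {s} {e} {f} d e′ c h₁ h₂ = begin
  e′ + ((d + s) + (d + s)) ≡⟨ regroup₁ s d e′ ⟩
  (e′ + (d + d)) + (s + s) ≤⟨ +-monoˡ-≤ (s + s) h₂ ⟩
  (e + c) + (s + s)        ≡⟨ regroup₂ s e c ⟩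
  c + (e + (s + s))        ≤⟨ +-monoʳ-≤ c h₁ ⟩
  c + f                    ∎
  where
  open ≤-Reasoning
  regroup₁ : ∀ s d e′ → e′ + ((d + s) + (d + s)) ≡ (e′ + (d + d)) + (s + s)
  regroup₁ = solve-∀
  regroup₂ : ∀ s e c → (e + c) + (s + s) ≡ c + (e + (s + s))
  regroup₂ = solve-∀

half-≤ : ∀ {s m} → s + s ≤ m → s ≤ m / 2
half-≤ {s} {m} h = subst (_≤ m / 2) (m*n/n≡m s 2) (/-monoˡ-≤ 2 (subst (_≤ m) (double s) h))
  where
  double : ∀ s → s + s ≡ s * 2
  double = solve-∀

x∉p⇒∣p∣<∣p∪⁅x⁆∣ : ∀ {n} {p : Subset n} {x} → x ∉ p → ∣ p ∣ < ∣ p ∪ ⁅ x ⁆ ∣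
x∉p⇒∣p∣<∣p∪⁅x⁆∣ {x = x} x∉p = p⊂q⇒∣p∣<∣q∣ (p⊆p∪q ⁅ x ⁆ , x , x∈p∪q⁺ (inj₂ (x∈⁅x⁆ x)) , x∉p)

x∉p⇒∣p∣<n : ∀ {n} {p : Subset n} {x} → x ∉ p → ∣ p ∣ < n
x∉p⇒∣p∣<n {n} {p} {x} x∉p = subst (∣ p ∣ <_) (∣⊤∣≡n n) (p⊂q⇒∣p∣<∣q∣ ((λ _ → ∈⊤) , x , ∈⊤ , x∉p))

n≤∣p∣⇒x∈p : ∀ {n} {p : Subset n} {x} → n ≤ ∣ p ∣ → x ∈ p
n≤∣p∣⇒x∈p {p = p} {x} n≤ with x ∈? p
... | yes x∈p = x∈p
... | no  x∉p = contradiction n≤ (<⇒≱ (x∉p⇒∣p∣<n x∉p))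

infixl 6 _⊕_
_⊕_ : ∀ {N} → Distribution N → Distribution N → Distribution N
(p ⊕ q) i = p i + q i

𝟘 : ∀ {N} → Distribution N
𝟘 _ = 0

δ : ∀ {N} → Fin N → Distribution N
δ v = updateAt 𝟘 v suc

infix 4 _≤ᴰ_
_≤ᴰ_ : ∀ {N} → Distribution N → Distribution N → Set
p ≤ᴰ q = ∀ i → p i ≤ q i

δ-self : ∀ {N} (v : Fin N) → δ v v ≡ 1
δ-self v = updateAt-updates v 𝟘

1≤δ-self : ∀ {N} (v : Fin N) → 1 ≤ δ v v
1≤δ-self v = ≤-reflexive (sym (δ-self v))

1≤updateAt-suc : ∀ {N} (p : Distribution N) (v : Fin N) → 1 ≤ updateAt p v suc v
1≤updateAt-suc p v = subst (1 ≤_) (sym (updateAt-updates v p)) (s≤s z≤n)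

p≤ᴰp⊕q : ∀ {N} (p q : Distribution N) → p ≤ᴰ p ⊕ q
p≤ᴰp⊕q p q i = m≤m+n (p i) (q i)

updateAt-mono : ∀ {N} {p p′ r : Distribution N} {f g : ℕ → ℕ} (j : Fin N) →
                p ⊕ r ≤ᴰ p′ → f (p j) + r j ≤ g (p′ j) →
                updateAt p j f ⊕ r ≤ᴰ updateAt p′ j g
updateAt-mono {p = p} {p′} {r} {f} {g} j le le-j i with i ≟ᶠ j
... | yes refl rewrite updateAt-updates i {f} p | updateAt-updates i {g} p′ = le-j
... | no i≢j   rewrite updateAt-minimal i j {f} p i≢j | updateAt-minimal i j {g} p′ i≢j = le i

surplus-at : ∀ {N} {p p′ r : Distribution N} {v} k {m} → p ⊕ r ≤ᴰ p′ → p v ≡ k + m →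
             ∃[ m′ ] (p′ v ≡ k + m′ × m + r v ≤ m′)
surplus-at {p′ = p′} {r} {v} k {m} le pv≡ =
  k+m≤n⇒∃n′ k (subst (_≤ p′ v) (trans (cong (_+ r v) pv≡) (+-assoc k m (r v))) (le v))

size-⊕ : ∀ {N} (p q : Distribution N) → size (p ⊕ q) ≡ size p + size q
size-⊕ {zero}  p q = refl
size-⊕ {suc N} p q =
  trans (cong (p fzero + q fzero +_) (size-⊕ (λ i → p (fsuc i)) (λ i → q (fsuc i))))
        (interchange (p fzero) (q fzero) _ _)

size-𝟘 : ∀ N → size {N} 𝟘 ≡ 0
size-𝟘 zero    = refl
size-𝟘 (suc N) = size-𝟘 N

size-updateAt-suc : ∀ {N} (p : Distribution N) (v : Fin N) →
                    size (updateAt p v suc) ≡ suc (size p)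
size-updateAt-suc {suc N} p fzero    = refl
size-updateAt-suc {suc N} p (fsuc v) =
  trans (cong (p fzero +_) (size-updateAt-suc (λ i → p (fsuc i)) v)) (+-suc (p fzero) _)

size-δ : ∀ {N} (v : Fin N) → size (δ v) ≡ 1
size-δ {N} v = trans (size-updateAt-suc 𝟘 v) (cong suc (size-𝟘 N))

size-δ-⊕ : ∀ {N} (v : Fin N) (p : Distribution N) → size (δ v ⊕ p) ≡ 1 + size p
size-δ-⊕ v p = trans (size-⊕ (δ v) p) (cong (_+ size p) (size-δ v))

module _ {N : ℕ} (G : SimpleGraph N) where

  Obtainable : Distribution N → Fin N → ℕ → Set
  Obtainable p v k = ∃[ q ] (Star (Move G) p q × k ≤ q v)

  move-lift : ∀ {p q r p′} → Move G p q → p ⊕ r ≤ᴰ p′ →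
              ∃[ q′ ] (Move G p′ q′ × q ⊕ r ≤ᴰ q′)
  move-lift {r = r} {p′} (pebble p v u k vu pv≡) le with surplus-at {p = p} {p′} {r} 2 le pv≡
  ... | k′ , p′v≡ , k≤k′ =
    _ , pebble p′ v u k′ vu p′v≡ , updateAt-mono u removed (s≤s (removed u))
    where
    removed : updateAt p v (λ _ → k) ⊕ r ≤ᴰ updateAt p′ v (λ _ → k′)
    removed = updateAt-mono v le k≤k′
  move-lift {r = r} {p′} (rubble p v w u a b v≢w vu wu pv≡ pw≡) le
    with surplus-at {p = p} {p′} {r} 1 le pv≡ | surplus-at {p = p} {p′} {r} 1 le pw≡
  ... | a′ , p′v≡ , a≤a′ | b′ , p′w≡ , b≤b′ =
    _ , rubble p′ v w u a′ b′ v≢w vu wu p′v≡ p′w≡ , updateAt-mono u removed (s≤s (removed u))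
    where
    removed : updateAt (updateAt p v (λ _ → a)) w (λ _ → b) ⊕ r
              ≤ᴰ updateAt (updateAt p′ v (λ _ → a′)) w (λ _ → b′)
    removed = updateAt-mono w (updateAt-mono v le a≤a′) b≤b′

  moves-lift : ∀ {p q r p′} → Star (Move G) p q → p ⊕ r ≤ᴰ p′ →
               ∃[ q′ ] (Star (Move G) p′ q′ × q ⊕ r ≤ᴰ q′)
  moves-lift ε        le = _ , ε , le
  moves-lift (m ◅ ms) le with move-lift m le
  ... | _ , m′ , le₁ with moves-lift ms le₁
  ... | q′ , ms′ , le₂ = q′ , m′ ◅ ms′ , le₂

  obtainable-here : ∀ {p v k} → k ≤ p v → Obtainable p v k
  obtainable-here h = _ , ε , h

  obtainable-after : ∀ {p q v k} → Star (Move G) p q → Obtainable q v k → Obtainable p v k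
  obtainable-after ms (q′ , ms′ , h) = q′ , ms ◅◅ ms′ , h

  obtainable-⊕ : ∀ {p v k} (r : Distribution N) → Obtainable p v k →
                 Obtainable (p ⊕ r) v (k + r v)
  obtainable-⊕ r (q , ms , h) with moves-lift {r = r} ms (λ _ → ≤-refl)
  ... | q′ , ms′ , le = q′ , ms′ , ≤-trans (+-monoˡ-≤ _ h) (le _)

  obtainable-mono : ∀ {p p′ v k} → p ≤ᴰ p′ → Obtainable p v k → Obtainable p′ v k
  obtainable-mono {p} le (q , ms , h)
    with moves-lift {r = 𝟘} ms (λ i → subst (_≤ _) (sym (+-identityʳ (p i))) (le i))
  ... | q′ , ms′ , le′ = q′ , ms′ , ≤-trans h (≤-trans (m≤m+n _ 0) (le′ _))

  pebble-reaches : ∀ {q u v} → Adj G u v → 2 ≤ q u → Reachable G q v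
  pebble-reaches {q} {u} {v} uv h with k+m≤n⇒∃n′ 2 h
  ... | k , qu≡ , _ = _ , pebble q u v k uv qu≡ ◅ ε , 1≤updateAt-suc _ v

  rubble-reaches : ∀ {q u g v} → ¬ u ≡ g → Adj G u v → Adj G g v → 1 ≤ q u → 1 ≤ q g →
                   Reachable G q v
  rubble-reaches {q} {u} {g} {v} u≢g uv gv hu hg with k+m≤n⇒∃n′ 1 hu | k+m≤n⇒∃n′ 1 hg
  ... | a , qu≡ , _ | b , qg≡ , _ =
    _ , rubble q u g v a b u≢g uv gv qu≡ qg≡ ◅ ε , 1≤updateAt-suc _ v

  pebble-to-each : ∀ {p v gs} → Obtainable p v 2 → All (Adj G v) gs →
                   Reachable G p v × All (Reachable G p) gs
  pebble-to-each (q , ms , two) vgs =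
    (q , ms , ≤-trans (s≤s z≤n) two) , All-map (λ vg → obtainable-after ms (pebble-reaches vg two)) vgs

  -- When g = u the pebble on g doubles the one at u, and a pebbling move replaces the rubbling move.
  rubble-step : ∀ {p u g v} → Adj G u v → Adj G g v → Reachable G p u → Reachable G (p ⊕ δ g) v
  rubble-step {u = u} {g} uv gv (q , ms , hu) with moves-lift {r = δ g} ms (λ _ → ≤-refl)
  ... | q′ , ms′ , le with u ≟ᶠ g
  ... | yes refl = obtainable-after ms′ (pebble-reaches uv (≤-trans (+-mono-≤ hu (1≤δ-self u)) (le u)))
  ... | no u≢g   = obtainable-after ms′ (rubble-reaches u≢g uv gv
                     (≤-trans hu (≤-trans (m≤m+n _ _) (le u)))
                     (≤-trans (1≤δ-self g) (≤-trans (m≤n+m _ _) (le g))))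

  -- The subtrees below v: each child c of v together with the subtrees below c.  A rooted
  -- tree is encoded by its root and the forest below it (see InTree).
  data Forest (v : Fin N) : Set where
    []   : Forest v
    cons : ∀ {c} → Adj G v c → Forest c → Forest v → Forest v

  sizeF : ∀ {v} → Forest v → ℕ
  sizeF []             = 0
  sizeF (cons _ F′ F) = suc (sizeF F′) + sizeF F

  mutual
    InTree : (c : Fin N) → Forest c → Fin N → Set
    InTree c F t = t ≡ c ⊎ t ∈F F

    data _∈F_ (t : Fin N) : ∀ {v} → Forest v → Set where
      first : ∀ {v c F′ F} {vc : Adj G v c} → InTree c F′ t → t ∈F cons vc F′ F
      rest  : ∀ {v c F′ F} {vc : Adj G v c} → t ∈F F → t ∈F cons vc F′ F

  Covers : (Distribution N → Set) → Distribution N → (Fin N → Set) → Set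
  Covers H p X = ∀ A → H A → ∀ t → X t → Reachable G (A ⊕ p) t

  covers-weaken : ∀ {H H′ p X} → (∀ {A} → H′ A → H A) → Covers H p X → Covers H′ p X
  covers-weaken H′⇒H cov A h = cov A (H′⇒H h)

  covers-shift : ∀ {H p X} (d : Distribution N) → Covers H p X →
                 Covers (λ A → H (A ⊕ d)) (d ⊕ p) X
  covers-shift {p = p} d cov A h t x =
    obtainable-mono (λ i → ≤-reflexive (+-assoc (A i) (d i) (p i))) (cov (A ⊕ d) h t x)

  covers-root : ∀ {H : Distribution N → Set} {p c} {F : Forest c} →
                Covers (λ A → Reachable G A c × H A) p (_∈F F) →
                Covers (λ A → Reachable G A c × H A) p (InTree c F)
  covers-root {p = p} cov A (hc , _) t (inj₁ refl) = obtainable-mono (p≤ᴰp⊕q A p) hc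
  covers-root         cov A h        t (inj₂ t∈F)  = cov A h t t∈F

  covers-cons : ∀ {H p q v c F′ F} {vc : Adj G v c} →
                Covers H p (InTree c F′) → Covers H q (_∈F F) →
                Covers H (p ⊕ q) (_∈F cons vc F′ F)
  covers-cons {p = p} {q} covT covF A h t (first t∈T) =
    obtainable-mono (λ i → +-monoʳ-≤ (A i) (m≤m+n (p i) (q i))) (covT A h t t∈T)
  covers-cons {p = p} {q} covT covF A h t (rest t∈F)  =
    obtainable-mono (λ i → +-monoʳ-≤ (A i) (m≤n+m (q i) (p i))) (covF A h t t∈F)

  data SubtreePlan (u c : Fin N) (F : Forest c) : Set where
    viaParent : (p : Distribution N) → size p + size p ≤ suc (sizeF F) →
                Covers (λ A → Reachable G A u) p (InTree c F) → SubtreePlan u c F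
    viaRoot   : (p : Distribution N) → size p + size p ≤ sizeF F →
                Covers (λ A → Reachable G A c) p (InTree c F) → SubtreePlan u c F

  -- rootFed lists the children of v whose subtree plan is viaRoot.
  record ForestPlan (v : Fin N) (F : Forest v) : Set where
    field
      pebbles  : Distribution N
      rootFed  : List (Fin N)
      adjacent : All (Adj G v) rootFed
      bound    : length rootFed + (size pebbles + size pebbles) ≤ sizeF F
      covers   : Covers (λ A → Reachable G A v × All (Reachable G A) rootFed) pebbles (_∈F F)

  emptyPlan : ∀ {v} → ForestPlan v []
  emptyPlan = record
    { pebbles  = 𝟘
    ; rootFed  = []
    ; adjacent = []
    ; bound    = ≤-reflexive (cong (λ s → s + s) (size-𝟘 N))
    ; covers   = λ _ _ _ ()
    }

  consPlan : ∀ {v c F′ F} (vc : Adj G v c) → SubtreePlan v c F′ → ForestPlan v F →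
             ForestPlan v (cons vc F′ F)
  consPlan vc (viaParent p bnd cov) P = record
    { pebbles  = p ⊕ pebbles
    ; rootFed  = rootFed
    ; adjacent = adjacent
    ; bound    = subst (λ s → length rootFed + (s + s) ≤ _) (sym (size-⊕ p pebbles))
                       (double-+-mono-≤ {size p} {size pebbles} {0} {length rootFed} bnd bound)
    ; covers   = covers-cons (covers-weaken (λ (h , _) → h) cov) covers
    }
    where open ForestPlan P
  consPlan {c = c} vc (viaRoot p bnd cov) P = record
    { pebbles  = p ⊕ pebbles
    ; rootFed  = c ∷ rootFed
    ; adjacent = vc ∷ adjacent
    ; bound    = subst (λ s → suc (length rootFed) + (s + s) ≤ _) (sym (size-⊕ p pebbles))
                       (double-+-mono-≤ {size p} {size pebbles} {1} {length rootFed} (s≤s bnd) bound)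
    ; covers   = covers-cons (covers-weaken (λ { (_ , hc ∷ _) → hc }) cov)
                             (covers-weaken (λ { (h , _ ∷ hs) → h , hs }) covers)
    }
    where open ForestPlan P

  nodePlan : ∀ {u c F} → Adj G u c → ForestPlan c F → SubtreePlan u c F
  nodePlan uc record { pebbles = p ; rootFed = [] ; bound = bnd ; covers = cov } =
    viaRoot p bnd (covers-weaken (λ h → h , []) (covers-root cov))
  nodePlan {u} {c} {F} uc
           record { pebbles = p ; rootFed = g ∷ [] ; adjacent = cg ∷ [] ; bound = bnd ; covers = cov } =
    viaParent (δ g ⊕ p) bound′ (covers-weaken supply (covers-shift (δ g) (covers-root cov)))
    where
    bound′ : size (δ g ⊕ p) + size (δ g ⊕ p) ≤ suc (sizeF F)
    bound′ = subst (λ s → s + s ≤ _) (sym (size-δ-⊕ g p)) (double-shift-≤ {e = 1} 1 0 1 bnd ≤-refl)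
    supply : ∀ {A} → Reachable G A u → Reachable G (A ⊕ δ g) c × All (Reachable G (A ⊕ δ g)) (g ∷ [])
    supply {A} h = rubble-step uc (SimpleGraph.sym G cg) h ,
                   obtainable-here (≤-trans (1≤δ-self g) (m≤n+m _ (A g))) ∷ []
  nodePlan {c = c} {F} uc
           record { pebbles = p ; rootFed = _ ∷ _ ∷ gs ; adjacent = cgs ; bound = bnd ; covers = cov } =
    viaRoot (δ c ⊕ p) bound′
      (covers-weaken (λ h → pebble-to-each (two-at-root h) cgs) (covers-shift (δ c) (covers-root cov)))
    where
    bound′ : size (δ c ⊕ p) + size (δ c ⊕ p) ≤ sizeF F
    bound′ = subst (λ s → s + s ≤ _) (sym (size-δ-⊕ c p))
                   (double-shift-≤ {e = 2 + length gs} 1 0 0 bnd (s≤s (s≤s z≤n)))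
    two-at-root : ∀ {A} → Reachable G A c → Obtainable (A ⊕ δ c) c 2
    two-at-root h = subst (Obtainable _ c) (cong suc (δ-self c)) (obtainable-⊕ (δ c) h)

  forestPlan : ∀ {v} (F : Forest v) → ForestPlan v F
  forestPlan []             = emptyPlan
  forestPlan (cons vc F′ F) = consPlan vc (nodePlan vc (forestPlan F′)) (forestPlan F)

  rootPlan : ∀ {r F} → ForestPlan r F →
             ∃[ p ] ((∀ t → InTree r F t → Reachable G p t) × size p + size p ≤ 3 + sizeF F)
  rootPlan {r} record { pebbles = p ; rootFed = [] ; bound = bnd ; covers = cov } =
    δ r ⊕ p ,
    covers-root cov (δ r) (obtainable-here (1≤δ-self r) , []) ,
    subst (λ s → s + s ≤ _) (sym (size-δ-⊕ r p)) (double-shift-≤ {e = 0} 1 0 3 bnd (s≤s (s≤s z≤n)))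
  rootPlan {r} record { pebbles = p ; rootFed = _ ∷ gs ; adjacent = rgs ; bound = bnd ; covers = cov } =
    δ r ⊕ δ r ⊕ p ,
    covers-root cov (δ r ⊕ δ r) (pebble-to-each two-at-root rgs) ,
    subst (λ s → s + s ≤ _) (sym size-δδ-⊕)
          (double-shift-≤ {e = 1 + length gs} 2 0 3 bnd (s≤s (m≤n+m 3 (length gs))))
    where
    two-at-root : Obtainable (δ r ⊕ δ r) r 2
    two-at-root = obtainable-here (+-mono-≤ (1≤δ-self r) (1≤δ-self r))
    size-δδ-⊕ : size (δ r ⊕ δ r ⊕ p) ≡ 2 + size p
    size-δδ-⊕ = trans (size-⊕ (δ r ⊕ δ r) p)
                      (cong (_+ size p) (trans (size-⊕ (δ r) (δ r)) (cong₂ _+_ (size-δ r) (size-δ r))))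

  graft : ∀ {v w x} (F : Forest v) → InTree v F w → Adj G w x → Forest v
  graft F              (inj₁ refl)        wx = cons wx [] F
  graft (cons vc F′ F) (inj₂ (first w∈)) wx = cons vc (graft F′ w∈ wx) F
  graft (cons vc F′ F) (inj₂ (rest w∈))  wx = cons vc F′ (graft F (inj₂ w∈) wx)

  sizeF-graft : ∀ {v w x} (F : Forest v) (w∈ : InTree v F w) (wx : Adj G w x) →
                sizeF (graft F w∈ wx) ≡ suc (sizeF F)
  sizeF-graft F              (inj₁ refl)        wx = refl
  sizeF-graft (cons vc F′ F) (inj₂ (first w∈)) wx = cong (λ s → suc s + sizeF F) (sizeF-graft F′ w∈ wx)
  sizeF-graft (cons vc F′ F) (inj₂ (rest w∈))  wx =
    trans (cong (suc (sizeF F′) +_) (sizeF-graft F (inj₂ w∈) wx)) (+-suc (suc (sizeF F′)) (sizeF F))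

  graft-new : ∀ {v w x} (F : Forest v) (w∈ : InTree v F w) (wx : Adj G w x) → x ∈F graft F w∈ wx
  graft-new F              (inj₁ refl)        wx = first (inj₁ refl)
  graft-new (cons vc F′ F) (inj₂ (first w∈)) wx = first (inj₂ (graft-new F′ w∈ wx))
  graft-new (cons vc F′ F) (inj₂ (rest w∈))  wx = rest (graft-new F (inj₂ w∈) wx)

  mutual
    graft-keeps : ∀ {v w x t} (F : Forest v) (w∈ : InTree v F w) (wx : Adj G w x) →
                  InTree v F t → InTree v (graft F w∈ wx) t
    graft-keeps F w∈ wx (inj₁ t≡v) = inj₁ t≡v
    graft-keeps F w∈ wx (inj₂ t∈F) = inj₂ (graft-keeps-∈F F w∈ wx t∈F)

    graft-keeps-∈F : ∀ {v w x t} (F : Forest v) (w∈ : InTree v F w) (wx : Adj G w x) →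
                     t ∈F F → t ∈F graft F w∈ wx
    graft-keeps-∈F F              (inj₁ refl)        wx t∈F         = rest t∈F
    graft-keeps-∈F (cons vc F′ F) (inj₂ (first w∈)) wx (first t∈T) = first (graft-keeps F′ w∈ wx t∈T)
    graft-keeps-∈F (cons vc F′ F) (inj₂ (first w∈)) wx (rest t∈F)  = rest t∈F
    graft-keeps-∈F (cons vc F′ F) (inj₂ (rest w∈))  wx (first t∈T) = first t∈T
    graft-keeps-∈F (cons vc F′ F) (inj₂ (rest w∈))  wx (rest t∈F)  =
      rest (graft-keeps-∈F F (inj₂ w∈) wx t∈F)

  walk-exits : ∀ {ℓ} {P : Pred (Fin N) ℓ} → Decidable P → ∀ {a b} → Walk G a b → P a → ¬ P b →
               ∃[ w ] ∃[ x ] (P w × Adj G w x × ¬ P x)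
  walk-exits P? here                   Pa ¬Pb = contradiction Pa ¬Pb
  walk-exits P? (step {u} {v} uv walk) Pu ¬Pb with P? v
  ... | yes Pv = walk-exits P? walk Pv ¬Pb
  ... | no ¬Pv = u , v , Pu , uv , ¬Pv

  SpanningTree : Fin N → Set
  SpanningTree r = ∃[ F ] ((∀ t → InTree r F t) × suc (sizeF F) ≤ N)

  record PartialSpanningTree (r : Fin N) : Set where
    field
      covered : Subset N
      forest  : Forest r
      root∈   : r ∈ covered
      spans   : ∀ {t} → t ∈ covered → InTree r forest t
      small   : suc (sizeF forest) ≤ ∣ covered ∣

  open PartialSpanningTree

  singletonTree : (r : Fin N) → PartialSpanningTree r
  singletonTree r = record
    { covered = ⁅ r ⁆
    ; forest  = []
    ; root∈   = x∈⁅x⁆ r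
    ; spans   = λ t∈ → inj₁ (x∈⁅y⁆⇒x≡y r t∈)
    ; small   = ≤-reflexive (sym (∣⁅x⁆∣≡1 r))
    }

  extend : ∀ {r w x} (T : PartialSpanningTree r) → w ∈ covered T → Adj G w x → x ∉ covered T →
           Σ (PartialSpanningTree r) λ T′ → ∣ covered T ∣ < ∣ covered T′ ∣
  extend {r} {w} {x} T w∈ wx x∉ = record
    { covered = covered T ∪ ⁅ x ⁆
    ; forest  = forest′
    ; root∈   = p⊆p∪q ⁅ x ⁆ (root∈ T)
    ; spans   = spans′
    ; small   = subst (_≤ ∣ covered T ∪ ⁅ x ⁆ ∣) (cong suc (sym (sizeF-graft (forest T) w∈T wx)))
                      (≤-trans (s≤s (small T)) grows)
    } , grows
    where
    w∈T : InTree r (forest T) w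
    w∈T = spans T w∈
    forest′ : Forest r
    forest′ = graft (forest T) w∈T wx
    grows : ∣ covered T ∣ < ∣ covered T ∪ ⁅ x ⁆ ∣
    grows = x∉p⇒∣p∣<∣p∪⁅x⁆∣ x∉
    spans′ : ∀ {t} → t ∈ covered T ∪ ⁅ x ⁆ → InTree r forest′ t
    spans′ t∈ with x∈p∪q⁻ (covered T) ⁅ x ⁆ t∈
    ... | inj₁ t∈old = graft-keeps (forest T) w∈T wx (spans T t∈old)
    ... | inj₂ t∈new rewrite x∈⁅y⁆⇒x≡y x t∈new = inj₂ (graft-new (forest T) w∈T wx)

  complete : ∀ {r} (T : PartialSpanningTree r) → (∀ t → t ∈ covered T) → SpanningTree r
  complete T all∈ = forest T , (λ t → spans T (all∈ t)) , ≤-trans (small T) (∣p∣≤n (covered T))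

  grow : Connected G → ∀ {r} (k : ℕ) (T : PartialSpanningTree r) → N ≤ ∣ covered T ∣ + k → SpanningTree r
  grow conn zero    T N≤ = complete T (λ t → n≤∣p∣⇒x∈p (subst (N ≤_) (+-identityʳ _) N≤))
  grow conn {r} (suc k) T N≤ with all? (_∈? covered T)
  ... | yes all∈ = complete T all∈
  ... | no ¬all∈ with ¬∀⟶∃¬ N _ (_∈? covered T) ¬all∈
  ... | x , x∉ with walk-exits (_∈? covered T) (conn r x) (root∈ T) x∉
  ... | w , x′ , w∈ , wx′ , x′∉ with extend T w∈ wx′ x′∉
  ... | T′ , grows = grow conn k T′ (≤-trans N≤ (≤-trans (≤-reflexive (+-suc _ k)) (+-monoˡ-≤ k grows)))

  spanningTree : Connected G → (r : Fin N) → SpanningTree r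
  spanningTree conn r = grow conn N (singletonTree r) (m≤n+m N _)

mainTheorem10 : (n : ℕ) (G : SimpleGraph (suc n)) → Connected G →
    OptRubblingAtMost G (ceilHalfSucc (suc n))
mainTheorem10 n G conn with spanningTree G conn fzero
... | F , spans , small with rootPlan G (forestPlan G F)
... | p , covers , bound = p , (λ t → covers t (spans t)) , half-≤ (≤-trans bound tree-bound)
  where
  tree-bound : 3 + sizeF G F ≤ suc n + 2
  tree-bound = s≤s (≤-trans (+-monoʳ-≤ 2 (≤-pred small)) (≤-reflexive (+-comm 2 n)))
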